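{- Let $M$ be a complete multirooted non-ambiguous binary tree. Then $M$ has a dot which has both a dot to its left in its row and a dot above it in its column if and only if $M$ has more than one root.
   Context: For $\pi\in\mathfrak{S}_n$, $\mathcal{T}_\pi$ is the $n\times n$ grid (cell $(i,j)$ = row $i$ from top, column $j$ from left) with dots in cells $(\pi_i,i)$. A complete multirooted non-ambiguous binary tree (CMNAB) is obtained from some $\mathcal{T}_\pi$ by adding $n-1$ further dots (internal dots) in empty cells such that (1) every internal dot has a dot below it in its column and a dot to its right in its row; (2) the graph on all dots obtained by joining consecutive dots in a common row or common column is a tree. A root of $M$ is a dot with no dot to its left in its row and no dot above it in its column. -}

module Defs where

open import Data.Nat using (ℕ; _∸_; _≤_)
open import Data.Fin using (Fin; _<_)
open import Data.Fin.Permutation using (Permutation′; _⟨$⟩ʳ_)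
open import Data.Product using (Σ; _×_; _,_; ∃)
open import Data.Sum using (_⊎_)
open import Data.List using (List; []; _∷_; _++_; length)
open import Data.List.Membership.Propositional using (_∈_)
open import Data.List.Relation.Unary.Unique.Propositional using (Unique)
open import Data.List.Relation.Unary.Linked using (Linked)
open import Data.List.Relation.Unary.All using (All)
open import Relation.Binary.PropositionalEquality using (_≡_; _≢_)
open import Relation.Binary.Construct.Closure.ReflexiveTransitive using (Star)
open import Relation.Nullary using (¬_)

-- A cell (i , j): row i (from the top), column j (from the left).
Cell : ℕ → Set
Cell n = Fin n × Fin n

-- Dots of T_π together with a list of extra (internal) dots.
record Config (n : ℕ) : Set where
  field
    perm     : Permutation′ n
    internal : List (Cell n)

  PermDot : Cell n → Set
  PermDot (r , c) = perm ⟨$⟩ʳ c ≡ r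

  Dot : Cell n → Set
  Dot x = PermDot x ⊎ x ∈ internal

  data Edge : Cell n → Cell n → Set where
    row : ∀ {r c₁ c₂} → c₁ < c₂ → Dot (r , c₁) → Dot (r , c₂) →
          (∀ c → c₁ < c → c < c₂ → ¬ Dot (r , c)) → Edge (r , c₁) (r , c₂)
    col : ∀ {c r₁ r₂} → r₁ < r₂ → Dot (r₁ , c) → Dot (r₂ , c) →
          (∀ r → r₁ < r → r < r₂ → ¬ Dot (r , c)) → Edge (r₁ , c) (r₂ , c)

  Adj : Cell n → Cell n → Set
  Adj x y = Edge x y ⊎ Edge y x

  Connected : Set
  Connected = ∀ x y → Dot x → Dot y → Star Adj x y

  IsCycle : Cell n → List (Cell n) → Set
  IsCycle x ys = 2 ≤ length ys × Unique (x ∷ ys) × Linked Adj (x ∷ (ys ++ (x ∷ [])))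

  Acyclic : Set
  Acyclic = ∀ x ys → ¬ IsCycle x ys

  IsTree : Set
  IsTree = Connected × Acyclic

  DotLeft DotRight DotAbove DotBelow : Cell n → Set
  DotLeft  (r , c) = ∃ λ c′ → c′ < c × Dot (r , c′)
  DotRight (r , c) = ∃ λ c′ → c < c′ × Dot (r , c′)
  DotAbove (r , c) = ∃ λ r′ → r′ < r × Dot (r′ , c)
  DotBelow (r , c) = ∃ λ r′ → r < r′ × Dot (r′ , c)

  IsRoot : Cell n → Set
  IsRoot x = Dot x × ¬ DotLeft x × ¬ DotAbove x

record IsCMNAB {n : ℕ} (M : Config n) : Set where
  open Config M
  field
    internal-unique : Unique internal
    internal-count  : length internal ≡ n ∸ 1
    internal-empty  : All (λ x → ¬ PermDot x) internal
    internal-below  : All DotBelow internal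
    internal-right  : All DotRight internal
    tree            : IsTree

-- Call p a parent of a dot x when p is the nearest dot to the left of x in its row or the
-- nearest dot above x in its column; the edges of the tree join exactly the dots to their
-- parents.  Parents have smaller row+column weight, so climbing through parents always ends
-- at a root.  A dot with a dot to its left and one above has two parents; climbing from both
-- must end at different roots, since otherwise the two climbs close up to a cycle.
-- Conversely, if no dot has two parents, the root reached by climbing is unchanged along
-- every edge, so by connectedness all roots coincide.
module Submission where

open import Defs
open import Data.Nat using (ℕ)
open import Data.Product using (∃; _×_)
open import Function.Bundles using (_⇔_; mk⇔)
open import Relation.Binary.PropositionalEquality using (_≢_)

import Data.Nat as ℕ
import Data.Nat.Properties as ℕ
open import Data.Nat.Induction using (<-wellFounded)
open import Data.Fin as Fin using (Fin; toℕ)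
import Data.Fin.Properties as Fin
open import Data.Fin.Permutation using (_⟨$⟩ʳ_)
open import Data.Product using (_,_; proj₁; proj₂; ∃₂)
open import Data.Product.Properties using (≡-dec)
open import Data.Sum using (_⊎_; inj₁; inj₂)
import Data.Sum as Sum
open import Data.Empty using (⊥; ⊥-elim)
open import Data.List using (List; []; _∷_; _++_; [_]; length; reverse; reverseAcc; head)
open import Data.List.Properties using (++-assoc; unfold-reverse; reverse-++; length-reverse)
open import Data.List.Membership.Propositional using (_∈_; _∉_)
open import Data.List.Membership.Propositional.Properties using (∈-∃++; ∈-++⁺ˡ)
open import Data.List.Relation.Unary.Any using (here; there)
import Data.List.Relation.Unary.Any.Properties as Any
open import Data.List.Relation.Unary.All using (All)
import Data.List.Relation.Unary.All as All
import Data.List.Relation.Unary.AllPairs as AllPairs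
import Data.List.Relation.Unary.First as First
open import Data.List.Relation.Unary.First.Properties using (toView)
open import Data.List.Relation.Unary.Linked using (Linked; []; [-]; _∷_)
import Data.List.Relation.Unary.Linked as Linked
open import Data.List.Relation.Unary.Linked.Properties using (Linked⇒All; Linked⇒AllPairs)
open import Data.List.Relation.Unary.Unique.Propositional using (Unique)
import Data.List.Relation.Unary.Unique.Propositional.Properties as Unique
open import Function using (flip; _∘_; _on_)
open import Induction.WellFounded using (Acc; acc)
open import Relation.Binary.Construct.On as On using ()
open import Relation.Binary.Construct.Closure.ReflexiveTransitive using (Star; ε; _◅_)
open import Relation.Binary.Definitions using (DecidableEquality; Transitive; Irreflexive; tri<; tri≈; tri>)
open import Relation.Binary.PropositionalEquality using (_≡_; refl; sym; cong; subst; module ≡-Reasoning)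
open import Relation.Nullary using (¬_; Dec; yes; no)
open import Relation.Nullary.Decidable using (_×-dec_; _⊎-dec_; map′; toSum)
open import Relation.Unary using (Decidable)

module _ {A : Set} {R : A → A → Set} where

  Linked-++⁻ˡ : ∀ xs {ys} → Linked R (xs ++ ys) → Linked R xs
  Linked-++⁻ˡ []           _        = []
  Linked-++⁻ˡ (x ∷ [])     _        = [-]
  Linked-++⁻ˡ (x ∷ y ∷ xs) (r ∷ rs) = r ∷ Linked-++⁻ˡ (y ∷ xs) rs

  Linked-upTo : ∀ xs {y ys} → Linked R (xs ++ y ∷ ys) → Linked R (xs ++ [ y ])
  Linked-upTo []            _        = [-]
  Linked-upTo (x ∷ [])      (r ∷ _)  = r ∷ [-]
  Linked-upTo (x ∷ x′ ∷ xs) (r ∷ rs) = r ∷ Linked-upTo (x′ ∷ xs) rs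

  Linked-glue : ∀ xs {y ys} → Linked R (xs ++ [ y ]) → Linked R (y ∷ ys) → Linked R (xs ++ y ∷ ys)
  Linked-glue []            _        h = h
  Linked-glue (x ∷ [])      (r ∷ _)  h = r ∷ h
  Linked-glue (x ∷ x′ ∷ xs) (r ∷ rs) h = r ∷ Linked-glue (x′ ∷ xs) rs h

  Linked-reverseAcc⁺ : ∀ {x} zs xs → Linked (flip R) (x ∷ zs) → Linked R (x ∷ xs) →
                       Linked (flip R) (reverseAcc (x ∷ zs) xs)
  Linked-reverseAcc⁺ zs []       h _        = h
  Linked-reverseAcc⁺ zs (y ∷ ys) h (r ∷ rs) = Linked-reverseAcc⁺ _ ys (r ∷ h) rs

  Linked-reverse⁺ : ∀ {xs} → Linked R xs → Linked (flip R) (reverse xs)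
  Linked-reverse⁺ {[]}     _ = []
  Linked-reverse⁺ {x ∷ xs} h = Linked-reverseAcc⁺ [] xs [-] h

  Linked⇒Unique : Transitive R → Irreflexive _≡_ R → ∀ {xs} → Linked R xs → Unique xs
  Linked⇒Unique trans irrefl = AllPairs.map (λ r eq → irrefl eq r) ∘ Linked⇒AllPairs trans

split-at-first-shared : ∀ {A : Set} → DecidableEquality A → ∀ {xs ys : List A} {w} → w ∈ xs → w ∈ ys →
  ∃ λ xs₁ → ∃ λ v → ∃ λ xs₂ → xs ≡ xs₁ ++ v ∷ xs₂ × All (_∉ ys) xs₁ × v ∈ ys
split-at-first-shared _≟_ {xs} {ys} w∈xs w∈ys with First.first (Sum.swap ∘ toSum ∘ (_∈? ys)) xs
  where open import Data.List.Membership.DecPropositional _≟_ using (_∈?_)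
... | inj₂ none∈ys = ⊥-elim (All.lookup none∈ys w∈xs w∈ys)
... | inj₁ firstShared with toView firstShared
...   | First._++_∷_ xs₁∉ys v∈ys xs₂ = _ , _ , xs₂ , refl , xs₁∉ys , v∈ys

greatest-below-ℕ : (Q : ℕ → Set) → (∀ k → Dec (Q k)) → ∀ a b → a ℕ.< b → Q a →
  ∃ λ m → m ℕ.< b × Q m × (∀ k → m ℕ.< k → k ℕ.< b → ¬ Q k)
greatest-below-ℕ Q Q? a (ℕ.suc b) a<1+b qa with Q? b
... | yes qb = b , ℕ.n<1+n b , qb , λ k b<k k<1+b _ → ℕ.<⇒≱ b<k (ℕ.≤-pred k<1+b)
... | no ¬qb with a ℕ.≟ b
...   | yes refl = ⊥-elim (¬qb qa)
...   | no a≢b with greatest-below-ℕ Q Q? a b (ℕ.≤∧≢⇒< (ℕ.≤-pred a<1+b) a≢b) qa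
...     | m , m<b , qm , gap = m , ℕ.m<n⇒m<1+n m<b , qm , gap′
  where
  gap′ : ∀ k → m ℕ.< k → k ℕ.< ℕ.suc b → ¬ Q k
  gap′ k m<k k<1+b with k ℕ.≟ b
  ... | yes refl = ¬qb
  ... | no k≢b   = gap k m<k (ℕ.≤∧≢⇒< (ℕ.≤-pred k<1+b) k≢b)

greatest-below : ∀ {n} (P : Fin n → Set) → Decidable P → ∀ {a b : Fin n} → a Fin.< b → P a →
  ∃ λ m → m Fin.< b × P m × (∀ k → m Fin.< k → k Fin.< b → ¬ P k)
greatest-below {n} P P? {a} {b} a<b pa
  with greatest-below-ℕ (λ k → ∃ λ (g : Fin n) → toℕ g ≡ k × P g)
         (λ k → Fin.any? (λ g → (toℕ g ℕ.≟ k) ×-dec P? g)) (toℕ a) (toℕ b) a<b (a , refl , pa)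
... | _ , m<b , (m , refl , pm) , gap =
  m , m<b , pm , λ k m<k k<b pk → gap (toℕ k) m<k k<b (k , refl , pk)

greatest-below-unique : ∀ {n} {P : Fin n → Set} {a a′ b : Fin n} → a Fin.< b → a′ Fin.< b → P a → P a′ →
  (∀ k → a Fin.< k → k Fin.< b → ¬ P k) → (∀ k → a′ Fin.< k → k Fin.< b → ¬ P k) → a ≡ a′
greatest-below-unique {a = a} {a′} a<b a′<b pa pa′ gap gap′ with Fin.<-cmp a a′
... | tri< a<a′ _ _ = ⊥-elim (gap a′ a<a′ a′<b pa′)
... | tri≈ _ a≡a′ _ = a≡a′
... | tri> _ _ a′<a = ⊥-elim (gap′ a a′<a a<b pa)

module ParentGraph {A : Set} (_↑_ : A → A → Set) where

  Adjacent : A → A → Set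
  Adjacent x y = y ↑ x ⊎ x ↑ y

  Orphan : A → Set
  Orphan x = ∀ {p} → ¬ x ↑ p

  module UniqueParents (↑-unique : ∀ {x p q} → x ↑ p → x ↑ q → p ≡ q) where

    climbs-to-along-Adjacent : ∀ {ρ x y} → Orphan ρ → Star _↑_ x ρ → Adjacent x y → Star _↑_ y ρ
    climbs-to-along-Adjacent _ x↑*ρ               (inj₁ y↑x) = y↑x ◅ x↑*ρ
    climbs-to-along-Adjacent ρ-orphan ε           (inj₂ ρ↑y) = ⊥-elim (ρ-orphan ρ↑y)
    climbs-to-along-Adjacent {ρ} _ (x↑p ◅ p↑*ρ)   (inj₂ x↑y) =
      subst (λ p → Star _↑_ p ρ) (↑-unique x↑p x↑y) p↑*ρ

    climbs-to-along-path : ∀ {ρ x y} → Orphan ρ → Star _↑_ x ρ → Star Adjacent x y → Star _↑_ y ρ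
    climbs-to-along-path _        x↑*ρ ε       = x↑*ρ
    climbs-to-along-path ρ-orphan x↑*ρ (a ◅ s) =
      climbs-to-along-path ρ-orphan (climbs-to-along-Adjacent ρ-orphan x↑*ρ a) s

    connected-orphans-≡ : ∀ {ρ σ} → Orphan ρ → Orphan σ → Star Adjacent ρ σ → ρ ≡ σ
    connected-orphans-≡ ρ-orphan σ-orphan path with climbs-to-along-path ρ-orphan ε path
    ... | ε         = refl
    ... | σ↑p ◅ _   = ⊥-elim (σ-orphan σ↑p)

  module Ranked (_≟_ : DecidableEquality A) (rank : A → ℕ)
                (↑-rank : ∀ {x p} → x ↑ p → rank p ℕ.< rank x) where

    ascending-Unique : ∀ {xs} → Linked _↑_ xs → Unique xs
    ascending-Unique = Linked⇒Unique (flip ℕ.<-trans) (λ { refl → ℕ.<-irrefl refl }) ∘ Linked.map ↑-rank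

    descending-Unique : ∀ {xs} → Linked (flip _↑_) xs → Unique xs
    descending-Unique = Linked⇒Unique ℕ.<-trans (λ { refl → ℕ.<-irrefl refl }) ∘ Linked.map ↑-rank

    ascending-above : ∀ {z xs} → Linked _↑_ (z ∷ xs) → All (λ y → rank y ℕ.< rank z) xs
    ascending-above [-]       = All.[]
    ascending-above (z↑x ∷ h) = Linked⇒All (flip ℕ.<-trans) (↑-rank z↑x) (Linked.map ↑-rank h)

    climbs-meeting-twice⇒cycle : ∀ {z xs ys w} → Linked _↑_ (z ∷ xs) → Linked _↑_ (z ∷ ys) →
      head xs ≢ head ys → w ∈ xs → w ∈ ys →
      ∃ λ cyc → 2 ℕ.≤ length cyc × Unique (z ∷ cyc) × Linked Adjacent (z ∷ cyc ++ [ z ])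
    climbs-meeting-twice⇒cycle {z} z↑*xs z↑*ys heads≢ w∈xs w∈ys
      with xs₁ , v , xs₂ , refl , xs₁∉ys , v∈ys ← split-at-first-shared _≟_ w∈xs w∈ys
      with ys₁ , ys₂ , refl ← ∈-∃++ v∈ys
      = xs₁ ++ v ∷ reverse ys₁ , cycle-length xs₁ ys₁ heads≢ , unique , linked
      where
      cycle-length : ∀ as bs {xs₂ ys₂} → head (as ++ v ∷ xs₂) ≢ head (bs ++ v ∷ ys₂) →
                     2 ℕ.≤ length (as ++ v ∷ reverse bs)
      cycle-length []          []       heads≢ = ⊥-elim (heads≢ refl)
      cycle-length []          (b ∷ bs) _      =
        ℕ.s≤s (subst (1 ℕ.≤_) (sym (length-reverse (b ∷ bs))) (ℕ.s≤s ℕ.z≤n))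
      cycle-length (a ∷ [])    _        _      = ℕ.s≤s (ℕ.s≤s ℕ.z≤n)
      cycle-length (a ∷ _ ∷ _) _        _      = ℕ.s≤s (ℕ.s≤s ℕ.z≤n)

      reverse-eq : reverse (z ∷ ys₁ ++ [ v ]) ≡ v ∷ reverse ys₁ ++ [ z ]
      reverse-eq = begin
        reverse (z ∷ ys₁ ++ [ v ])        ≡⟨ unfold-reverse z (ys₁ ++ [ v ]) ⟩
        reverse (ys₁ ++ [ v ]) ++ [ z ]   ≡⟨ cong (_++ [ z ]) (reverse-++ ys₁ [ v ]) ⟩
        v ∷ reverse ys₁ ++ [ z ]          ∎
        where open ≡-Reasoning

      z↑*v : Linked _↑_ (z ∷ xs₁ ++ [ v ])
      z↑*v = Linked-upTo (z ∷ xs₁) z↑*xs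

      v↓*z : Linked (flip _↑_) (v ∷ reverse ys₁ ++ [ z ])
      v↓*z = subst (Linked (flip _↑_)) reverse-eq (Linked-reverse⁺ (Linked-upTo (z ∷ ys₁) z↑*ys))

      in-ys : ∀ {u} → u ∈ v ∷ reverse ys₁ → u ∈ ys₁ ++ v ∷ ys₂
      in-ys (here refl) = v∈ys
      in-ys (there u∈)  = ∈-++⁺ˡ {xs = ys₁} (Any.reverse⁻ u∈)

      disjoint : ∀ {u} → u ∈ z ∷ xs₁ → u ∈ v ∷ reverse ys₁ → ⊥
      disjoint (here refl) u∈ = ℕ.<-irrefl refl (All.lookup (ascending-above z↑*ys) (in-ys u∈))
      disjoint (there u∈xs₁) u∈ = All.lookup xs₁∉ys u∈xs₁ (in-ys u∈)

      unique : Unique (z ∷ xs₁ ++ v ∷ reverse ys₁)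
      unique = Unique.++⁺ (ascending-Unique (Linked-++⁻ˡ (z ∷ xs₁) z↑*xs))
                          (descending-Unique (Linked-++⁻ˡ (v ∷ reverse ys₁) v↓*z))
                          (λ (p , q) → disjoint p q)

      linked : Linked Adjacent (z ∷ (xs₁ ++ v ∷ reverse ys₁) ++ [ z ])
      linked = subst (λ l → Linked Adjacent (z ∷ l)) (sym (++-assoc xs₁ (v ∷ reverse ys₁) [ z ]))
                     (Linked-glue (z ∷ xs₁) (Linked.map inj₂ z↑*v) (Linked.map inj₁ v↓*z))

module _ {n : ℕ} (M : Config n) where
  open Config M

  _↑_ : Cell n → Cell n → Set
  x ↑ p = Edge p x

  open ParentGraph _↑_

  weight : Cell n → ℕ
  weight (r , c) = toℕ r ℕ.+ toℕ c

  Edge⇒weight< : ∀ {p x} → Edge p x → weight p ℕ.< weight x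
  Edge⇒weight< (row {r} c₁<c₂ _ _ _) = ℕ.+-monoʳ-< (toℕ r) c₁<c₂
  Edge⇒weight< (col {c} r₁<r₂ _ _ _) = ℕ.+-monoˡ-< (toℕ c) r₁<r₂

  Edge-source-Dot : ∀ {p x} → Edge p x → Dot p
  Edge-source-Dot (row _ d _ _) = d
  Edge-source-Dot (col _ d _ _) = d

  _≟_ : DecidableEquality (Cell n)
  _≟_ = ≡-dec Fin._≟_ Fin._≟_

  Dot? : Decidable Dot
  Dot? (r , c) = (perm ⟨$⟩ʳ c Fin.≟ r) ⊎-dec (r , c) ∈? internal
    where open import Data.List.Membership.DecPropositional _≟_ using (_∈?_)

  DotLeft? : Decidable DotLeft
  DotLeft? (r , c) = Fin.any? λ c′ → (c′ Fin.<? c) ×-dec Dot? (r , c′)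

  DotAbove? : Decidable DotAbove
  DotAbove? (r , c) = Fin.any? λ r′ → (r′ Fin.<? r) ×-dec Dot? (r′ , c)

  left-parent : ∀ {r c} → Dot (r , c) → DotLeft (r , c) → ∃ λ c′ → (r , c) ↑ (r , c′)
  left-parent {r} d (_ , c′<c , d′) with greatest-below (λ k → Dot (r , k)) (λ k → Dot? (r , k)) c′<c d′
  ... | _ , m<c , dm , gap = _ , row m<c dm d gap

  above-parent : ∀ {r c} → Dot (r , c) → DotAbove (r , c) → ∃ λ r′ → (r , c) ↑ (r′ , c)
  above-parent {c = c} d (_ , r′<r , d′) with greatest-below (λ k → Dot (k , c)) (λ k → Dot? (k , c)) r′<r d′
  ... | _ , m<r , dm , gap = _ , col m<r dm d gap

  IsRoot⇒Orphan : ∀ {x} → IsRoot x → Orphan x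
  IsRoot⇒Orphan (_ , ¬left , _) (row c₁<c₂ d _ _) = ¬left (_ , c₁<c₂ , d)
  IsRoot⇒Orphan (_ , _ , ¬above) (col r₁<r₂ d _ _) = ¬above (_ , r₁<r₂ , d)

  root-or-parent : ∀ {x} → Dot x → IsRoot x ⊎ ∃ (x ↑_)
  root-or-parent {x} d with DotLeft? x | DotAbove? x
  ... | yes left | _         = inj₂ (_ , proj₂ (left-parent d left))
  ... | no ¬left | yes above = inj₂ (_ , proj₂ (above-parent d above))
  ... | no ¬left | no ¬above = inj₁ (d , ¬left , ¬above)

  climb : ∀ {x} → Acc (ℕ._<_ on weight) x → Dot x →
          ∃₂ λ L ρ → Linked _↑_ (x ∷ L) × IsRoot ρ × ρ ∈ x ∷ L
  climb (acc rs) d with root-or-parent d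
  ... | inj₁ root = [] , _ , [-] , root , here refl
  ... | inj₂ (_ , x↑p) with climb (rs (Edge⇒weight< x↑p)) (Edge-source-Dot x↑p)
  ...   | L , ρ , p↑*ρ , root , ρ∈ = _ ∷ L , ρ , x↑p ∷ p↑*ρ , root , there ρ∈

  climb-to-root : ∀ {x} → Dot x → ∃₂ λ L ρ → Linked _↑_ (x ∷ L) × IsRoot ρ × ρ ∈ x ∷ L
  climb-to-root {x} = climb (On.wellFounded weight <-wellFounded x)

  open Ranked _≟_ weight Edge⇒weight<

  Junction : Set
  Junction = ∃ λ x → Dot x × DotLeft x × DotAbove x

  Junction? : Dec Junction
  Junction? = map′ (λ ((r , c , p)) → (r , c) , p) (λ (((r , c) , p)) → r , c , p)
    (Fin.any? λ r → Fin.any? λ c → Dot? (r , c) ×-dec DotLeft? (r , c) ×-dec DotAbove? (r , c))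

  junction⇒two-roots : Acyclic → Junction → ∃ λ x → ∃ λ y → x ≢ y × IsRoot x × IsRoot y
  junction⇒two-roots acyclic (z , d , left , above)
    with _ , z↑p₁ ← left-parent d left | _ , z↑p₂ ← above-parent d above
    with _ , ρ₁ , p₁↑*ρ₁ , root₁ , ρ₁∈ ← climb-to-root (Edge-source-Dot z↑p₁)
       | _ , ρ₂ , p₂↑*ρ₂ , root₂ , ρ₂∈ ← climb-to-root (Edge-source-Dot z↑p₂)
    with ρ₁ ≟ ρ₂
  ... | no ρ₁≢ρ₂ = ρ₁ , ρ₂ , ρ₁≢ρ₂ , root₁ , root₂
  ... | yes refl with cyc , cycle ← climbs-meeting-twice⇒cycle (z↑p₁ ∷ p₁↑*ρ₁) (z↑p₂ ∷ p₂↑*ρ₂)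
                                       (λ { refl → ℕ.<-irrefl refl (Edge⇒weight< z↑p₁) }) ρ₁∈ ρ₂∈
    = ⊥-elim (acyclic z cyc cycle)

  ¬Junction⇒↑-unique : ¬ Junction → ∀ {x p q} → x ↑ p → x ↑ q → p ≡ q
  ¬Junction⇒↑-unique _ (row c<c₂ d _ gap) (row c′<c₂ d′ _ gap′) =
    cong (_ ,_) (greatest-below-unique c<c₂ c′<c₂ d d′ gap gap′)
  ¬Junction⇒↑-unique _ (col r<r₂ d _ gap) (col r′<r₂ d′ _ gap′) =
    cong (_, _) (greatest-below-unique r<r₂ r′<r₂ d d′ gap gap′)
  ¬Junction⇒↑-unique ¬j (row c₁<c₂ d₁ d₂ _) (col r₁<r₂ d′ _ _) =
    ⊥-elim (¬j (_ , d₂ , (_ , c₁<c₂ , d₁) , (_ , r₁<r₂ , d′)))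
  ¬Junction⇒↑-unique ¬j (col r₁<r₂ d₁ d₂ _) (row c₁<c₂ d′ _ _) =
    ⊥-elim (¬j (_ , d₂ , (_ , c₁<c₂ , d′) , (_ , r₁<r₂ , d₁)))

  two-roots⇒junction : Connected → (∃ λ x → ∃ λ y → x ≢ y × IsRoot x × IsRoot y) → Junction
  two-roots⇒junction connected (ρ₁ , ρ₂ , ρ₁≢ρ₂ , root₁ , root₂) with Junction?
  ... | yes junction = junction
  ... | no ¬junction = ⊥-elim (ρ₁≢ρ₂ (connected-orphans-≡ (IsRoot⇒Orphan root₁) (IsRoot⇒Orphan root₂)
                                      (connected ρ₁ ρ₂ (proj₁ root₁) (proj₁ root₂))))
    where open UniqueParents (¬Junction⇒↑-unique ¬junction)

lemma4p10 : ∀ {n : ℕ} (M : Config n) → IsCMNAB M →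
    (∃ λ x → Config.Dot M x × Config.DotLeft M x × Config.DotAbove M x)
      ⇔ (∃ λ x → ∃ λ y → x ≢ y × Config.IsRoot M x × Config.IsRoot M y)
lemma4p10 M cmnab = mk⇔ (junction⇒two-roots M (proj₂ tree)) (two-roots⇒junction M (proj₁ tree))
  where open IsCMNAB cmnab using (tree)
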